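{- Let $G$, $S$, $M$, $A,B,C,D$ be as in the context. Let $\mathcal{C}$ be a connected component of $G[S]$ that contains no linked $D$ pairs. Then there is no $D$ pair $S_u$ in $\mathcal{C}$ such that $d_A(u)=d_B(u)=d_D(u)=1$.
   Context: Let $G=(V,E)$ be a finite simple connected cubic graph. A paired dominating set (PDS) of $G$ is a set $S\subseteq V$ such that every vertex of $V\setminus S$ has a neighbor in $S$ and $G[S]$ has a perfect matching. Let $S$ be a PDS of minimum size and $M$ a perfect matching of $G[S]$. For $u\in S$ let $\overline{u}$ denote the vertex with $u\overline{u}\in M$, and call $S_u=\{u,\overline{u}\}$ a pair. For $x\in V\setminus S$ let $N_S(x)=N(x)\cap S$; $x$ is a private neighbor of $u\in S$ if $N_S(x)=\{u\}$. Define $A=\{v\in S: v$ and $\overline{v}$ together have at least two private neighbors$\}$, $B=\{v\in S: v$ has a private neighbor and $\overline{v}$ has none$\}$, $C=\{v\in S:\overline{v}\in B\}$, $D=\{v\in S:$ neither $v$ nor $\overline{v}$ has a private neighbor$\}$. Let $\lambda(S)$ be the number of edges of $G[S]$. The pair $(S,M)$ is chosen among all minimum PDSs and perfect matchings of their induced subgraphs so that (P1) $\lambda(S)$ is minimum, and (P2) subject to (P1), $|A\cup B|$ is minimum. A $D$ pair is a pair with both vertices in $D$. Two $D$ pairs joined by an edge of $G$ are called linked $D$ pairs. For $X\subseteq V$ and a vertex $u$, $d_X(u)=|N(u)\cap X|$. -}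

module Defs where

open import Data.Nat using (ℕ; zero; suc; _+_; _≤_; _≡ᵇ_; _<ᵇ_; _≤ᵇ_)
open import Data.Fin using (Fin; zero; suc; toℕ)
open import Data.Bool using (Bool; true; false; _∧_; _∨_; not; if_then_else_; T)
open import Data.Product using (_×_; Σ)
open import Data.Empty using (⊥)
open import Relation.Binary.PropositionalEquality using (_≡_)
open import Relation.Binary.Construct.Closure.ReflexiveTransitive using (Star)

count : ∀ {n} → (Fin n → Bool) → ℕ
count {zero} p = 0
count {suc n} p = (if p zero then 1 else 0) + count (λ i → p (suc i))

sumFin : ∀ {n} → (Fin n → ℕ) → ℕ
sumFin {zero} f = 0
sumFin {suc n} f = f zero + sumFin (λ i → f (suc i))

record Graph (n : ℕ) : Set where
  field
    adj   : Fin n → Fin n → Bool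
    sym   : ∀ u v → adj u v ≡ adj v u
    irrefl : ∀ u → adj u u ≡ false
open Graph public

VSet : ℕ → Set
VSet n = Fin n → Bool

module _ {n : ℕ} (G : Graph n) where

  deg : Fin n → ℕ
  deg v = count (adj G v)

  Cubic : Set
  Cubic = ∀ v → deg v ≡ 3

  Connected : Set
  Connected = ∀ u v → Star (λ a b → T (adj G a b)) u v

  dIn : VSet n → Fin n → ℕ
  dIn X u = count (λ w → adj G u w ∧ X w)

  Dominating : VSet n → Set
  Dominating S = ∀ x → S x ≡ false → Σ (Fin n) (λ y → T (adj G x y ∧ S y))

  -- m is a perfect matching of G[S], given by its partner map u ↦ ū on S
  -- (values of m outside S are irrelevant)
  IsPerfectMatching : VSet n → (Fin n → Fin n) → Set
  IsPerfectMatching S m =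
    ∀ u → T (S u) → T (S (m u)) × T (adj G u (m u)) × (m (m u) ≡ u)

  IsPDSwith : VSet n → (Fin n → Fin n) → Set
  IsPDSwith S m = Dominating S × IsPerfectMatching S m

  IsMinPDSwith : VSet n → (Fin n → Fin n) → Set
  IsMinPDSwith S m = IsPDSwith S m ×
    (∀ S' m' → IsPDSwith S' m' → count S ≤ count S')

  lam : VSet n → ℕ
  lam S = sumFin (λ u → count (λ v → (toℕ u <ᵇ toℕ v) ∧ S u ∧ S v ∧ adj G u v))

  privNb : VSet n → Fin n → Fin n → Bool
  privNb S u x = not (S x) ∧ S u ∧ adj G x u ∧ (count (λ w → S w ∧ adj G x w) ≡ᵇ 1)

  pn : VSet n → Fin n → ℕ
  pn S u = count (privNb S u)

  pnPair : VSet n → (Fin n → Fin n) → Fin n → ℕ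
  pnPair S m u = count (λ x → privNb S u x ∨ privNb S (m u) x)

  inA : VSet n → (Fin n → Fin n) → VSet n
  inA S m v = S v ∧ (2 ≤ᵇ pnPair S m v)

  inB : VSet n → (Fin n → Fin n) → VSet n
  inB S m v = S v ∧ (1 ≤ᵇ pn S v) ∧ (pn S (m v) ≡ᵇ 0)

  inC : VSet n → (Fin n → Fin n) → VSet n
  inC S m v = S v ∧ inB S m (m v)

  inD : VSet n → (Fin n → Fin n) → VSet n
  inD S m v = S v ∧ (pn S v ≡ᵇ 0) ∧ (pn S (m v) ≡ᵇ 0)

  sizeAB : VSet n → (Fin n → Fin n) → ℕ
  sizeAB S m = count (λ v → inA S m v ∨ inB S m v)

  IsChosen : VSet n → (Fin n → Fin n) → Set
  IsChosen S m = IsMinPDSwith S m ×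
    (∀ S' m' → IsMinPDSwith S' m' → lam S ≤ lam S') ×
    (∀ S' m' → IsMinPDSwith S' m' → lam S' ≡ lam S → sizeAB S m ≤ sizeAB S' m')

  InComp : VSet n → Fin n → Fin n → Set
  InComp S r u = Star (λ a b → T (S a ∧ S b ∧ adj G a b)) r u

  NoLinkedDPairs : VSet n → (Fin n → Fin n) → Fin n → Set
  NoLinkedDPairs S m r = ∀ x y → InComp S r x → InComp S r y →
    T (inD S m x) → T (inD S m y) → T (adj G x y) →
    (y ≡ m x → ⊥) → ⊥

module Submission where

-- Let u be a D vertex with neighbours ū, a ∈ A and b ∈ B.  Comparing private neighbours shows
-- that ū, a, b are distinct, so N(u) = {ū, a, b} ⊆ S.  Deleting ū and b̄ and pairing u with b
-- gives a smaller paired set, which by minimality leaves some x ∉ S undominated; the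
-- S-neighbours of x lie in {ū, b̄}, and since b̄ has no private neighbour, x is adjacent to ū.
-- Trading u for x and pairing x with ū then gives a minimum PDS whose induced subgraph has at
-- most λ(S) − 3 + 2 edges, contradicting (P1).

open import Defs renaming (sym to adj-sym)
open import Data.Bool using (Bool; true; false; _∧_; _∨_; not; if_then_else_; T)
import Data.Bool as Bool
open import Data.Bool.Properties using (T-∧; T-≡; T-not-≡; T?; ¬-not; ∧-zeroʳ; ∧-identityʳ; ∧-comm)
open import Data.Empty using (⊥; ⊥-elim)
open import Data.Fin using (Fin; zero; suc; toℕ)
open import Data.Fin.Properties using (_≟_; any?; toℕ-injective)
open import Data.List using (List; []; _∷_; length)
open import Data.List.Membership.Propositional using (_∈_)
open import Data.List.Relation.Unary.All as All using (All; []; _∷_)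
open import Data.List.Relation.Unary.All.Properties using (¬Any⇒All¬)
open import Data.List.Relation.Unary.Any as Any using (here; there)
open import Data.List.Relation.Unary.Unique.Propositional using (Unique; []; _∷_)
open import Data.Nat using (ℕ; zero; suc; _+_; _≤_; _<_; z≤n; s≤s; _<ᵇ_)
open import Data.Nat.Properties hiding (_≟_)
open import Algebra.Properties.CommutativeSemigroup +-commutativeSemigroup using (interchange; x∙yz≈y∙xz)
open import Data.Product using (∃; _×_; _,_; proj₁; proj₂)
open import Data.Sum using (_⊎_; inj₁; inj₂; [_,_]′)
open import Function using (_∘_; case_of_; Equivalence)
open import Relation.Nullary using (¬_; Dec; yes; no; does; contradiction)
open import Relation.Nullary.Decidable using (dec-true; dec-false; ¬?; _×-dec_)
open import Relation.Binary.PropositionalEquality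

open Equivalence using (to; from)

private variable
  n : ℕ
  p q : Fin n → Bool
  f g : Fin n → ℕ

¬T⇒≡false : ∀ {b} → ¬ T b → b ≡ false
¬T⇒≡false ¬b = ¬-not (¬b ∘ from T-≡)

-- Vertex sets and partner maps

infixl 6 _─_ _∪⁅_⁆
_─_ : (Fin n → Bool) → Fin n → Fin n → Bool
(p ─ i) v = if does (v ≟ i) then false else p v

_∪⁅_⁆ : (Fin n → Bool) → Fin n → Fin n → Bool
(p ∪⁅ i ⁆) v = if does (v ≟ i) then true else p v

─-intro : ∀ {i v} → T (p v) → v ≢ i → T ((p ─ i) v)
─-intro {i = i} {v} pᵥ v≢i with v ≟ i
... | yes v≡i = contradiction v≡i v≢i
... | no _ = pᵥ

─-elim : ∀ {i v} → T ((p ─ i) v) → T (p v) × v ≢ i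
─-elim {i = i} {v} t with v ≟ i
... | no v≢i = t , v≢i

─-self : ∀ i → (p ─ i) i ≡ false
─-self i rewrite dec-true (i ≟ i) refl = refl

─-other : ∀ {i v} → v ≢ i → (p ─ i) v ≡ p v
─-other {i = i} {v} v≢i rewrite dec-false (v ≟ i) v≢i = refl

∪⁅⁆-self : ∀ i → T ((p ∪⁅ i ⁆) i)
∪⁅⁆-self i rewrite dec-true (i ≟ i) refl = _

∪⁅⁆-⊇ : ∀ {i v} → T (p v) → T ((p ∪⁅ i ⁆) v)
∪⁅⁆-⊇ {i = i} {v} pᵥ with v ≟ i
... | yes _ = _
... | no _ = pᵥ

∪⁅⁆-other : ∀ {i v} → v ≢ i → (p ∪⁅ i ⁆) v ≡ p v
∪⁅⁆-other {i = i} {v} v≢i rewrite dec-false (v ≟ i) v≢i = refl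

∪⁅⁆-─ : ∀ {i} → p i ≡ false → ∀ v → (p ∪⁅ i ⁆ ─ i) v ≡ p v
∪⁅⁆-─ {i = i} pᵢ≡false v with v ≟ i
... | yes refl = sym pᵢ≡false
... | no _ = refl

rematch : Fin n → Fin n → (Fin n → Fin n) → Fin n → Fin n
rematch p q m v = if does (v ≟ p) then q else if does (v ≟ q) then p else m v

rematch-left : ∀ (p q : Fin n) m → rematch p q m p ≡ q
rematch-left p q m rewrite dec-true (p ≟ p) refl = refl

rematch-right : ∀ {p q : Fin n} {m} → q ≢ p → rematch p q m q ≡ p
rematch-right {p = p} {q} q≢p rewrite dec-false (q ≟ p) q≢p | dec-true (q ≟ q) refl = refl

rematch-other : ∀ {p q v : Fin n} {m} → v ≢ p → v ≢ q → rematch p q m v ≡ m v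
rematch-other {p = p} {q} {v} v≢p v≢q rewrite dec-false (v ≟ p) v≢p | dec-false (v ≟ q) v≢q = refl

-- Counting

indicator : Bool → ℕ
indicator b = if b then 1 else 0

count-cong : (∀ i → p i ≡ q i) → count p ≡ count q
count-cong {zero} _ = refl
count-cong {suc n} eq = cong₂ _+_ (cong indicator (eq zero)) (count-cong (eq ∘ suc))

count-mono : (∀ i → T (p i) → T (q i)) → count p ≤ count q
count-mono {zero} _ = z≤n
count-mono {suc n} {p} {q} p⇒q = +-mono-≤ (indicator-mono (p zero) (q zero) (p⇒q zero)) (count-mono (p⇒q ∘ suc))
  where
  indicator-mono : ∀ a b → (T a → T b) → indicator a ≤ indicator b
  indicator-mono false _ _ = z≤n
  indicator-mono true true _ = ≤-refl
  indicator-mono true false a⇒b = ⊥-elim (a⇒b _)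

count-none : (∀ i → ¬ T (p i)) → count p ≡ 0
count-none {zero} _ = refl
count-none {suc n} {p} none with p zero | none zero
... | false | _ = count-none (none ∘ suc)
... | true | ¬t = contradiction _ ¬t

count-witness : 0 < count p → ∃ λ i → T (p i)
count-witness {p = p} 0<count with any? (λ i → T? (p i))
... | yes w = w
... | no ¬w = contradiction (count-none λ i t → ¬w (i , t)) (>⇒≢ 0<count)

count-─ : ∀ (p : Fin n → Bool) i → count p ≡ indicator (p i) + count (p ─ i)
count-─ {suc n} p zero = refl
count-─ {suc n} p (suc i) = begin
  indicator (p zero) + count (p ∘ suc)
    ≡⟨ cong (indicator (p zero) +_) (count-─ (p ∘ suc) i) ⟩
  indicator (p zero) + (indicator (p (suc i)) + count (p ∘ suc ─ i))
    ≡⟨ x∙yz≈y∙xz (indicator (p zero)) (indicator (p (suc i))) (count (p ∘ suc ─ i)) ⟩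
  indicator (p (suc i)) + count (p ─ suc i)
    ∎
  where open ≡-Reasoning

count-remove : ∀ (p : Fin n → Bool) {i} → T (p i) → count p ≡ suc (count (p ─ i))
count-remove p {i} pᵢ with p i | count-─ p i
... | true | eq = eq

count-partition : ∀ (p q : Fin n → Bool) → count p ≡ count (λ i → p i ∧ q i) + count (λ i → p i ∧ not (q i))
count-partition {zero} _ _ = refl
count-partition {suc n} p q = begin
  indicator (p zero) + count (p ∘ suc)
    ≡⟨ cong₂ _+_ (split (p zero) (q zero)) (count-partition (p ∘ suc) (q ∘ suc)) ⟩
  (indicator (p zero ∧ q zero) + indicator (p zero ∧ not (q zero))) + (count (p∧q ∘ suc) + count (p∧¬q ∘ suc))
    ≡⟨ interchange (indicator (p zero ∧ q zero)) _ _ _ ⟩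
  count p∧q + count p∧¬q ∎
  where
  open ≡-Reasoning
  p∧q p∧¬q : Fin (suc n) → Bool
  p∧q i = p i ∧ q i
  p∧¬q i = p i ∧ not (q i)
  split : ∀ a b → indicator a ≡ indicator (a ∧ b) + indicator (a ∧ not b)
  split false _ = refl
  split true false = refl
  split true true = refl

count-∨ : count (λ i → p i ∨ q i) ≤ count p + count q
count-∨ {p = p} {q} = begin
  count (λ i → p i ∨ q i)                                 ≡⟨ count-partition (λ i → p i ∨ q i) p ⟩
  count (λ i → (p i ∨ q i) ∧ p i) + count (λ i → (p i ∨ q i) ∧ not (p i))
    ≤⟨ +-mono-≤ (count-mono {q = p} λ i → proj₂ ∘ to T-∧) (count-mono {q = q} λ i → only-q i ∘ to T-∧) ⟩
  count p + count q                                       ∎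
  where
  open ≤-Reasoning
  only-q : ∀ i → T (p i ∨ q i) × T (not (p i)) → T (q i)
  only-q i (p∨q , ¬p) with p i
  ... | false = p∨q

length≤count : ∀ {xs} → Unique xs → All (T ∘ p) xs → length xs ≤ count p
length≤count [] [] = z≤n
length≤count {p = p} {x ∷ xs} (x≢xs ∷ unique) (px ∷ pxs) = begin
  suc (length xs)        ≤⟨ s≤s (length≤count unique (distinct x≢xs pxs)) ⟩
  suc (count (p ─ x))    ≡⟨ count-remove p px ⟨
  count p                ∎
  where
  open ≤-Reasoning
  distinct : ∀ {ys} → All (x ≢_) ys → All (T ∘ p) ys → All (T ∘ (p ─ x)) ys
  distinct [] [] = []
  distinct (x≢y ∷ x≢ys) (py ∷ pys) = ─-intro {p = p} py (x≢y ∘ sym) ∷ distinct x≢ys pys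

count≤length : ∀ xs → (∀ i → T (p i) → i ∈ xs) → count p ≤ length xs
count≤length [] ⊆[] = ≤-reflexive (count-none λ i pᵢ → case ⊆[] i pᵢ of λ ())
count≤length {p = p} (x ∷ xs) ⊆xs = begin
  count p                         ≡⟨ count-─ p x ⟩
  indicator (p x) + count (p ─ x) ≤⟨ +-mono-≤ (indicator≤1 (p x)) (count≤length xs ⊆tail) ⟩
  suc (length xs)                 ∎
  where
  open ≤-Reasoning
  indicator≤1 : ∀ b → indicator b ≤ 1
  indicator≤1 false = z≤n
  indicator≤1 true = ≤-refl
  ⊆tail : ∀ i → T ((p ─ x) i) → i ∈ xs
  ⊆tail i t with ─-elim {p = p} t
  ... | pᵢ , i≢x with ⊆xs i pᵢ
  ...   | here i≡x = contradiction i≡x i≢x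
  ...   | there i∈xs = i∈xs

count≡length⇒∈ : ∀ {xs : List (Fin n)} {i} → Unique xs → All (T ∘ p) xs → count p ≡ length xs →
                 T (p i) → i ∈ xs
count≡length⇒∈ {xs = xs} {i} unique pxs count≡ pᵢ with Any.any? (i ≟_) xs
... | yes i∈xs = i∈xs
... | no i∉xs = ⊥-elim (<-irrefl (sym count≡) (length≤count (¬Any⇒All¬ xs i∉xs ∷ unique) (pᵢ ∷ pxs)))

sumFin-cong : (∀ i → f i ≡ g i) → sumFin f ≡ sumFin g
sumFin-cong {zero} _ = refl
sumFin-cong {suc n} eq = cong₂ _+_ (eq zero) (sumFin-cong (eq ∘ suc))

sumFin-+ : ∀ (f g : Fin n → ℕ) → sumFin (λ i → f i + g i) ≡ sumFin f + sumFin g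
sumFin-+ {zero} _ _ = refl
sumFin-+ {suc n} f g = begin
  (f zero + g zero) + sumFin (λ i → f (suc i) + g (suc i))
    ≡⟨ cong (f zero + g zero +_) (sumFin-+ (f ∘ suc) (g ∘ suc)) ⟩
  (f zero + g zero) + (sumFin (f ∘ suc) + sumFin (g ∘ suc))
    ≡⟨ interchange (f zero) (g zero) _ _ ⟩
  sumFin f + sumFin g
    ∎
  where open ≡-Reasoning

sumFin-indicator : ∀ (p : Fin n → Bool) → sumFin (indicator ∘ p) ≡ count p
sumFin-indicator {zero} _ = refl
sumFin-indicator {suc n} p = cong (indicator (p zero) +_) (sumFin-indicator (p ∘ suc))

sumFin-point : ∀ (i : Fin n) c → sumFin (λ j → if does (j ≟ i) then c else 0) ≡ c
sumFin-point {suc n} zero c = trans (cong (c +_) (sumFin-zero n)) (+-identityʳ c)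
  where
  sumFin-zero : ∀ n → sumFin {n} (λ _ → 0) ≡ 0
  sumFin-zero zero = refl
  sumFin-zero (suc n) = sumFin-zero n
sumFin-point {suc n} (suc i) c = sumFin-point i c

-- Edges of an induced subgraph

infix 7 _≺_
_≺_ : Fin n → Fin n → Bool
u ≺ v = toℕ u <ᵇ toℕ v

≺-irrefl : ∀ (u : Fin n) → u ≺ u ≡ false
≺-irrefl u = ¬T⇒≡false (n≮n (toℕ u) ∘ <ᵇ⇒< (toℕ u) (toℕ u))

≺-flip : ∀ {u v : Fin n} → u ≢ v → not (v ≺ u) ≡ u ≺ v
≺-flip {u = u} {v} u≢v with u ≺ v in uv | v ≺ u in vu
... | true | false = refl
... | false | true = refl
... | true | true =
  contradiction (<ᵇ⇒< (toℕ v) (toℕ u) (subst T (sym vu) _)) (<⇒≯ (<ᵇ⇒< (toℕ u) (toℕ v) (subst T (sym uv) _)))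
... | false | false = contradiction (toℕ-injective (≤-antisym (≮⇒≥ (≺-false vu)) (≮⇒≥ (≺-false uv)))) u≢v
  where
  ≺-false : ∀ {x y : Fin n} → x ≺ y ≡ false → ¬ toℕ x < toℕ y
  ≺-false x≺y≡false x<y = subst T x≺y≡false (<⇒<ᵇ x<y)

∧-rotate-when : ∀ a r {c d} → (T r → c ≡ d) → (a ∧ r) ∧ c ≡ d ∧ r ∧ a
∧-rotate-when a false {d = d} _ rewrite ∧-zeroʳ a | ∧-zeroʳ d = refl
∧-rotate-when a true {c} {d} c≡d rewrite c≡d _ | ∧-identityʳ a = ∧-comm a d

module _ (G : Graph n) where

  adj-irrefl : ∀ {u v} → T (adj G u v) → u ≢ v
  adj-irrefl {u} uu refl = subst T (irrefl G u) uu

  adjacent-sym : ∀ {u v} → T (adj G u v) → T (adj G v u)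
  adjacent-sym {u} {v} = subst T (adj-sym G u v)

  row : VSet n → Fin n → ℕ
  row X u = count (λ v → u ≺ v ∧ X u ∧ X v ∧ adj G u v)

  row-absent : ∀ {X u} → X u ≡ false → row X u ≡ 0
  row-absent {X} {u} Xᵤ≡false = count-none {p = λ v → u ≺ v ∧ X u ∧ X v ∧ adj G u v} λ v t →
    subst T Xᵤ≡false (proj₁ (to T-∧ (proj₂ (to (T-∧ {u ≺ v}) t))))

  -- The edges of G[S] at i are those to vertices of S ─ i before i, each counted in the row of
  -- that vertex, and those to vertices after i, forming the row of i.
  module Removal (S : VSet n) (i : Fin n) (Sᵢ : T (S i)) where

    open ≡-Reasoning

    R : VSet n
    R = S ─ i
    below above : VSet n
    below u = u ≺ i ∧ R u ∧ adj G u i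
    above v = i ≺ v ∧ R v ∧ adj G i v
    point : Fin n → ℕ
    point u = if does (u ≟ i) then count above else 0

    row-centre : row S i ≡ count above
    row-centre = count-cong pointwise
      where
      pointwise : ∀ v → (i ≺ v ∧ S i ∧ S v ∧ adj G i v) ≡ above v
      pointwise v rewrite to T-≡ Sᵢ with v ≟ i
      ... | yes refl rewrite ≺-irrefl i = refl
      ... | no _ = refl

    row-off : ∀ {u} → u ≢ i → row S u ≡ row R u + indicator (below u)
    row-off {u} u≢i = begin
      row S u
        ≡⟨ count-─ _ i ⟩
      indicator (u ≺ i ∧ S u ∧ S i ∧ adj G u i) + count (edge ─ i)
        ≡⟨ cong₂ _+_ (cong indicator at-i) (count-cong off-i) ⟩
      indicator (below u) + row R u
        ≡⟨ +-comm (indicator (below u)) (row R u) ⟩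
      row R u + indicator (below u)
        ∎
      where
      edge : VSet n
      edge v = u ≺ v ∧ S u ∧ S v ∧ adj G u v
      at-i : (u ≺ i ∧ S u ∧ S i ∧ adj G u i) ≡ below u
      at-i rewrite to T-≡ Sᵢ | ─-other {p = S} u≢i = refl
      off-i : ∀ v → (edge ─ i) v ≡ (u ≺ v ∧ R u ∧ R v ∧ adj G u v)
      off-i v with v ≟ i
      ... | yes refl = sym (trans (cong (u ≺ v ∧_) (∧-zeroʳ (R u))) (∧-zeroʳ (u ≺ v)))
      ... | no _ rewrite ─-other {p = S} u≢i = refl

    point-self : point i ≡ count above
    point-self rewrite dec-true (i ≟ i) refl = refl

    point-other : ∀ {u} → u ≢ i → point u ≡ 0
    point-other {u} u≢i rewrite dec-false (u ≟ i) u≢i = refl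

    row-split : ∀ u → row S u ≡ row R u + (indicator (below u) + point u)
    row-split u = by-cases (u ≟ i)
      where
      by-cases : Dec (u ≡ i) → row S u ≡ row R u + (indicator (below u) + point u)
      by-cases (yes refl) = begin
        row S u
          ≡⟨ row-centre ⟩
        count above
          ≡⟨ point-self ⟨
        point u
          ≡⟨ cong₂ (λ r b → r + (indicator b + point u))
                   (row-absent {X = R} (─-self {p = S} u)) (cong (_∧ (R u ∧ adj G u u)) (≺-irrefl u)) ⟨
        row R u + (indicator (below u) + point u)
          ∎
      by-cases (no u≢i) = begin
        row S u
          ≡⟨ row-off u≢i ⟩
        row R u + indicator (below u)
          ≡⟨ cong (row R u +_) (+-identityʳ _) ⟨
        row R u + (indicator (below u) + 0)
          ≡⟨ cong (λ k → row R u + (indicator (below u) + k)) (point-other u≢i) ⟨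
        row R u + (indicator (below u) + point u)
          ∎

    split-by-≺ : dIn G R i ≡ count below + count above
    split-by-≺ = trans (count-partition _ (_≺ i)) (cong₂ _+_ (count-cong to-below) (count-cong to-above))
      where
      to-below : ∀ v → (adj G i v ∧ R v) ∧ v ≺ i ≡ below v
      to-below v = trans (∧-rotate-when (adj G i v) (R v) λ _ → refl)
                         (cong (λ a → v ≺ i ∧ R v ∧ a) (adj-sym G i v))
      to-above : ∀ v → (adj G i v ∧ R v) ∧ not (v ≺ i) ≡ above v
      to-above v = ∧-rotate-when (adj G i v) (R v) λ Rᵥ → ≺-flip (proj₂ (─-elim {p = S} Rᵥ) ∘ sym)

  lam-─ : ∀ (S : VSet n) i → T (S i) → lam G S ≡ lam G (S ─ i) + dIn G (S ─ i) i
  lam-─ S i Sᵢ = begin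
    sumFin (row S)
      ≡⟨ sumFin-cong row-split ⟩
    sumFin (λ u → row R u + (indicator (below u) + point u))
      ≡⟨ sumFin-+ (row R) _ ⟩
    lam G R + sumFin (λ u → indicator (below u) + point u)
      ≡⟨ cong (lam G R +_) (sumFin-+ (indicator ∘ below) point) ⟩
    lam G R + (sumFin (indicator ∘ below) + sumFin point)
      ≡⟨ cong (lam G R +_) (cong₂ _+_ (sumFin-indicator below) (sumFin-point i _)) ⟩
    lam G R + (count below + count above)
      ≡⟨ cong (lam G R +_) split-by-≺ ⟨
    lam G R + dIn G R i
      ∎
    where
    open ≡-Reasoning
    open Removal S i Sᵢ

  lam-cong : ∀ {X Y} → (∀ v → X v ≡ Y v) → lam G X ≡ lam G Y
  lam-cong X≗Y = sumFin-cong λ u → count-cong λ v →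
    cong₂ (λ x y → u ≺ v ∧ x ∧ y ∧ adj G u v) (X≗Y u) (X≗Y v)

  -- Paired dominating sets

  dominated? : ∀ (S : VSet n) x → Dec (∃ λ y → T (adj G x y ∧ S y))
  dominated? S x = any? (λ y → T? (adj G x y ∧ S y))

  dominating⊎undominated : ∀ (S : VSet n) →
    Dominating G S ⊎ ∃ λ x → S x ≡ false × ¬ ∃ (λ y → T (adj G x y ∧ S y))
  dominating⊎undominated S with any? (λ x → (S x Bool.≟ false) ×-dec ¬? (dominated? S x))
  ... | yes undominated = inj₂ undominated
  ... | no none = inj₁ dominating
    where
    dominating : Dominating G S
    dominating x Sₓ≡false with dominated? S x
    ... | yes neighbour = neighbour
    ... | no ¬neighbour = contradiction (x , Sₓ≡false , ¬neighbour) none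

  dominating-mono : ∀ {S S′} → (∀ v → T (S v) → T (S′ v)) → Dominating G S → Dominating G S′
  dominating-mono {S} {S′} S⊆S′ dom x S′ₓ≡false with dom x (¬T⇒≡false (subst T S′ₓ≡false ∘ S⊆S′ x))
  ... | y , xy∧Sy = y , from T-∧ (proj₁ (to T-∧ xy∧Sy) , S⊆S′ y (proj₂ (to T-∧ xy∧Sy)))

  dominating-─ : ∀ {S u w} → Dominating G S → (∀ v → T (adj G u v) → T (S v)) →
                 T (adj G u w) → Dominating G (S ─ u)
  dominating-─ {S} {u} {w} dom N[u]⊆S uw x S─uₓ≡false with x ≟ u
  ... | yes refl = w , from T-∧ (uw , ─-intro {p = S} (N[u]⊆S w uw) (adj-irrefl uw ∘ sym))
  ... | no x≢u with dom x S─uₓ≡false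
  ...   | y , xy∧Sy = y , from T-∧ (xy , ─-intro {p = S} (proj₂ (to T-∧ xy∧Sy)) y≢u)
    where
    xy : T (adj G x y)
    xy = proj₁ (to T-∧ xy∧Sy)
    y≢u : y ≢ u
    y≢u refl = subst T S─uₓ≡false (N[u]⊆S x (adjacent-sym xy))

  module _ {S m} (pm : IsPerfectMatching G S m) where

    partner-∈ : ∀ {v} → T (S v) → T (S (m v))
    partner-∈ Sᵥ = proj₁ (pm _ Sᵥ)

    partner-adj : ∀ {v} → T (S v) → T (adj G v (m v))
    partner-adj Sᵥ = proj₁ (proj₂ (pm _ Sᵥ))

    partner-involutive : ∀ {v} → T (S v) → m (m v) ≡ v
    partner-involutive Sᵥ = proj₂ (proj₂ (pm _ Sᵥ))

    partner-flip : ∀ {v w} → T (S w) → m w ≡ v → w ≡ m v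
    partner-flip S_w mw≡v = trans (sym (partner-involutive S_w)) (cong m mw≡v)

    partner-injective : ∀ {v w} → T (S v) → T (S w) → m v ≡ m w → v ≡ w
    partner-injective Sᵥ S_w mv≡mw = trans (partner-flip Sᵥ mv≡mw) (partner-involutive S_w)

    rematch-perfect : ∀ {S′ p q} → T (S′ p) → T (S′ q) → T (adj G p q) →
      (∀ v → T (S′ v) → v ≢ p → v ≢ q → T (S v) × T (S′ (m v)) × m v ≢ p × m v ≢ q) →
      IsPerfectMatching G S′ (rematch p q m)
    rematch-perfect {S′} {p} {q} S′ₚ S′_q pq others v S′ᵥ = by-cases (v ≟ p) (v ≟ q)
      where
      r : Fin n → Fin n
      r = rematch p q m
      partnered : ∀ {v w} → r v ≡ w → r w ≡ v → T (S′ w) → T (adj G v w) →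
                  T (S′ (r v)) × T (adj G v (r v)) × r (r v) ≡ v
      partnered refl rw≡v S′_w vw = S′_w , vw , rw≡v
      q≢p : q ≢ p
      q≢p = adj-irrefl pq ∘ sym
      by-cases : Dec (v ≡ p) → Dec (v ≡ q) → T (S′ (r v)) × T (adj G v (r v)) × r (r v) ≡ v
      by-cases (yes refl) _ = partnered (rematch-left v q m) (rematch-right {m = m} q≢p) S′_q pq
      by-cases (no _) (yes refl) = partnered (rematch-right {m = m} q≢p) (rematch-left p v m) S′ₚ (adjacent-sym pq)
      by-cases (no v≢p) (no v≢q) with others v S′ᵥ v≢p v≢q
      ... | Sᵥ , S′mᵥ , mv≢p , mv≢q =
        partnered (rematch-other {m = m} v≢p v≢q) (trans (rematch-other {m = m} mv≢p mv≢q) (partner-involutive Sᵥ))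
                  S′mᵥ (partner-adj Sᵥ)

  minimum-of-same-size : ∀ {S m S′ m′} → IsMinPDSwith G S m → IsPDSwith G S′ m′ → count S′ ≡ count S →
                         IsMinPDSwith G S′ m′
  minimum-of-same-size (_ , minimum) pds′ same =
    pds′ , λ S″ m″ pds″ → subst (_≤ count S″) (sym same) (minimum S″ m″ pds″)

  minimum-has-no-smaller : ∀ {S m S′ m′} → IsMinPDSwith G S m → IsPDSwith G S′ m′ → ¬ count S′ < count S
  minimum-has-no-smaller (_ , minimum) pds′ = ≤⇒≯ (minimum _ _ pds′)

  private-neighbour : ∀ {S v x} → S x ≡ false → T (S v) → T (adj G x v) →
                      (∀ w → T (S w ∧ adj G x w) → w ≡ v) → T (privNb G S v x)
  private-neighbour {S} {v} {x} Sₓ≡false Sᵥ xv only-v =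
    from T-∧ (from T-not-≡ Sₓ≡false , from T-∧ (Sᵥ , from T-∧ (xv , ≡⇒≡ᵇ _ 1 one)))
    where
    one : count (λ w → S w ∧ adj G x w) ≡ 1
    one = ≤-antisym (count≤length {p = λ w → S w ∧ adj G x w} (v ∷ []) λ w t → here (only-v w t))
                    (length≤count {p = λ w → S w ∧ adj G x w} ([] ∷ []) (from T-∧ (Sᵥ , xv) ∷ []))

  private-neighbour-outside : ∀ {S v x} → T (privNb G S v x) → ¬ T (S x) × T (adj G v x)
  private-neighbour-outside {S} {v} {x} t with to T-∧ t
  ... | ¬Sₓ , rest = subst T (to T-not-≡ ¬Sₓ) , adjacent-sym (proj₁ (to T-∧ (proj₂ (to (T-∧ {S v}) rest))))

  forced-neighbour : ∀ {S x p q} → Dominating G S → S x ≡ false →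
    (∀ y → T (adj G x y) → T (S y) → y ≡ p ⊎ y ≡ q) → T (S q) → pn G S q ≡ 0 → T (adj G x p)
  forced-neighbour {S} {x} {p} {q} dom Sₓ≡false N[x]∩S⊆pq S_q pn≡0 with T? (adj G x p)
  ... | yes xp = xp
  ... | no ¬xp with dom x Sₓ≡false
  ...   | y , xy∧S_y with N[x]∩S⊆pq y (proj₁ (to T-∧ xy∧S_y)) (proj₂ (to T-∧ xy∧S_y))
  ...     | inj₁ refl = ⊥-elim (¬xp (proj₁ (to T-∧ xy∧S_y)))
  ...     | inj₂ refl = contradiction pn≡0 (>⇒≢ (length≤count {p = privNb G S q} ([] ∷ []) (q-private ∷ [])))
    where
    only-q : ∀ w → T (S w ∧ adj G x w) → w ≡ q
    only-q w t with N[x]∩S⊆pq w (proj₂ (to T-∧ t)) (proj₁ (to T-∧ t))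
    ... | inj₁ refl = ⊥-elim (¬xp (proj₂ (to T-∧ t)))
    ... | inj₂ w≡q = w≡q
    q-private : T (privNb G S q x)
    q-private = private-neighbour Sₓ≡false S_q (proj₁ (to T-∧ xy∧S_y)) only-q

  pn≤1 : Cubic G → ∀ {S v} → 2 ≤ dIn G S v → pn G S v ≤ 1
  pn≤1 cubic {S} {v} 2≤dᵥ = ≤-pred (≤-pred (begin
    2 + pn G S v                                     ≤⟨ +-mono-≤ 2≤dᵥ (count-mono outside) ⟩
    dIn G S v + count (λ x → adj G v x ∧ not (S x))  ≡⟨ count-partition (adj G v) S ⟨
    count (adj G v)                                  ≡⟨ cubic v ⟩
    3                                                ∎))
    where
    open ≤-Reasoning
    outside : ∀ x → T (privNb G S v x) → T (adj G v x ∧ not (S x))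
    outside x t with private-neighbour-outside {S = S} t
    ... | ¬Sₓ , vx = from T-∧ (vx , from T-not-≡ (¬T⇒≡false ¬Sₓ))

  inA-elim : ∀ {S m v} → T (inA G S m v) → T (S v) × 2 ≤ pn G S v + pn G S (m v)
  inA-elim {S} {m} {v} t with to T-∧ t
  ... | Sᵥ , 2≤pnPair = Sᵥ , ≤-trans (≤ᵇ⇒≤ 2 _ 2≤pnPair) (count-∨ {p = privNb G S v} {q = privNb G S (m v)})

  inB-elim : ∀ {S m v} → T (inB G S m v) → T (S v) × 1 ≤ pn G S v × pn G S (m v) ≡ 0
  inB-elim {S} {m} {v} t with to T-∧ t
  ... | Sᵥ , rest with to T-∧ rest
  ...   | 1≤pn , pn≡0 = Sᵥ , ≤ᵇ⇒≤ 1 _ 1≤pn , ≡ᵇ⇒≡ _ 0 pn≡0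

  inD-elim : ∀ {S m v} → T (inD G S m v) → T (S v) × pn G S v ≡ 0 × pn G S (m v) ≡ 0
  inD-elim {S} {m} {v} t with to T-∧ t
  ... | Sᵥ , rest with to T-∧ rest
  ...   | pn≡0 , pn′≡0 = Sᵥ , ≡ᵇ⇒≡ _ 0 pn≡0 , ≡ᵇ⇒≡ _ 0 pn′≡0

  inB⇒¬inA : Cubic G → ∀ {S m v w} → IsPerfectMatching G S m → T (inB G S m v) →
             T (S w) → T (adj G v w) → w ≢ m v → ¬ T (inA G S m v)
  inB⇒¬inA cubic {S} {m} {v} {w} pm Bᵥ S_w vw w≢v̄ Aᵥ with inB-elim {S} {m} Bᵥ
  ... | Sᵥ , _ , pnv̄≡0 = <⇒≱ (proj₂ (inA-elim {S} {m} Aᵥ)) (begin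
    pn G S v + pn G S (m v)  ≡⟨ cong (pn G S v +_) pnv̄≡0 ⟩
    pn G S v + 0             ≡⟨ +-identityʳ _ ⟩
    pn G S v                 ≤⟨ pn≤1 cubic two-S-neighbours ⟩
    1                        ∎)
    where
    open ≤-Reasoning
    two-S-neighbours : 2 ≤ dIn G S v
    two-S-neighbours = length≤count {p = λ x → adj G v x ∧ S x} ((w≢v̄ ∷ []) ∷ [] ∷ [])
      (from T-∧ (vw , S_w) ∷ from T-∧ (partner-adj pm Sᵥ , partner-∈ pm Sᵥ) ∷ [])

  inD⇒partner-¬inA : ∀ {S m v} → IsPerfectMatching G S m → T (inD G S m v) → ¬ T (inA G S m (m v))
  inD⇒partner-¬inA {S} {m} {v} pm Dᵥ Aᵥ̄ with inD-elim {S} {m} Dᵥ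
  ... | Sᵥ , pnᵥ≡0 , pnᵥ̄≡0 =
    <⇒≱ (proj₂ (inA-elim {S} {m} Aᵥ̄)) (subst (_≤ 1) (sym no-private-neighbours) z≤n)
    where
    no-private-neighbours : pn G S (m v) + pn G S (m (m v)) ≡ 0
    no-private-neighbours = cong₂ _+_ pnᵥ̄≡0 (trans (cong (pn G S) (partner-involutive pm Sᵥ)) pnᵥ≡0)

  -- The two exchanges

  module Merge {S m u b} (pm : IsPerfectMatching G S m) (Sᵤ : T (S u)) (S_b : T (S b))
               (ub : T (adj G u b)) (b≢ū : b ≢ m u) where

    S⁻ : VSet n
    S⁻ = S ─ m u ─ m b

    S⁻-intro : ∀ {v} → T (S v) → v ≢ m u → v ≢ m b → T (S⁻ v)
    S⁻-intro Sᵥ v≢ū v≢b̄ = ─-intro {p = S ─ m u} (─-intro {p = S} Sᵥ v≢ū) v≢b̄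

    S⁻-elim : ∀ {v} → T (S⁻ v) → T (S v) × v ≢ m u × v ≢ m b
    S⁻-elim t with ─-elim {p = S ─ m u} t
    ... | t′ , v≢b̄ with ─-elim {p = S} t′
    ...   | Sᵥ , v≢ū = Sᵥ , v≢ū , v≢b̄

    S⁻ᵤ : T (S⁻ u)
    S⁻ᵤ = S⁻-intro Sᵤ (adj-irrefl (partner-adj pm Sᵤ)) (b≢ū ∘ partner-flip pm S_b ∘ sym)

    S⁻_b : T (S⁻ b)
    S⁻_b = S⁻-intro S_b b≢ū (adj-irrefl (partner-adj pm S_b))

    merged-perfect : IsPerfectMatching G S⁻ (rematch u b m)
    merged-perfect = rematch-perfect pm S⁻ᵤ S⁻_b ub others
      where
      others : ∀ v → T (S⁻ v) → v ≢ u → v ≢ b → T (S v) × T (S⁻ (m v)) × m v ≢ u × m v ≢ b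
      others v S⁻ᵥ v≢u v≢b with S⁻-elim S⁻ᵥ
      ... | Sᵥ , v≢ū , v≢b̄ =
        Sᵥ ,
        S⁻-intro (partner-∈ pm Sᵥ) (v≢u ∘ partner-injective pm Sᵥ Sᵤ) (v≢b ∘ partner-injective pm Sᵥ S_b) ,
        v≢ū ∘ partner-flip pm Sᵥ , v≢b̄ ∘ partner-flip pm Sᵥ

    merged-smaller : count S⁻ < count S
    merged-smaller = begin-strict
      count S⁻                   <⟨ n<1+n _ ⟩
      suc (count S⁻)             ≡⟨ count-remove (S ─ m u) (─-intro {p = S} (partner-∈ pm S_b) b̄≢ū) ⟨
      count (S ─ m u)            <⟨ n<1+n _ ⟩
      suc (count (S ─ m u))      ≡⟨ count-remove S (partner-∈ pm Sᵤ) ⟨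
      count S                    ∎
      where
      open ≤-Reasoning
      b̄≢ū : m b ≢ m u
      b̄≢ū = adj-irrefl ub ∘ sym ∘ partner-injective pm S_b Sᵤ

    outside-S : ∀ {x} → S⁻ x ≡ false → ¬ ∃ (λ y → T (adj G x y ∧ S⁻ y)) → S x ≡ false
    outside-S {x} S⁻ₓ≡false undominated = ¬T⇒≡false λ Sₓ → by-cases Sₓ (x ≟ m u) (x ≟ m b)
      where
      dominated-by : ∀ {y} → T (adj G y x) → T (S⁻ y) → ⊥
      dominated-by yx S⁻_y = undominated (_ , from T-∧ (adjacent-sym yx , S⁻_y))
      by-cases : T (S x) → Dec (x ≡ m u) → Dec (x ≡ m b) → ⊥
      by-cases _ (yes refl) _ = dominated-by (partner-adj pm Sᵤ) S⁻ᵤ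
      by-cases _ _ (yes refl) = dominated-by (partner-adj pm S_b) S⁻_b
      by-cases Sₓ (no x≢ū) (no x≢b̄) = subst T S⁻ₓ≡false (S⁻-intro Sₓ x≢ū x≢b̄)

    S-neighbours : ∀ {x} → ¬ ∃ (λ y → T (adj G x y ∧ S⁻ y)) →
                   ∀ y → T (adj G x y) → T (S y) → y ≡ m u ⊎ y ≡ m b
    S-neighbours undominated y xy S_y with y ≟ m u | y ≟ m b
    ... | yes y≡ū | _ = inj₁ y≡ū
    ... | no _ | yes y≡b̄ = inj₂ y≡b̄
    ... | no y≢ū | no y≢b̄ = ⊥-elim (undominated (y , from T-∧ (xy , S⁻-intro S_y y≢ū y≢b̄)))

  undominated-after-merging : ∀ {S m u b} → IsMinPDSwith G S m → T (S u) → T (S b) → T (adj G u b) → b ≢ m u →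
    ∃ λ x → S x ≡ false × (∀ y → T (adj G x y) → T (S y) → y ≡ m u ⊎ y ≡ m b)
  undominated-after-merging minimum@((_ , pm) , _) Sᵤ S_b ub b≢ū =
    [ ⊥-elim ∘ not-dominating
    , (λ (x , S⁻ₓ≡false , undominated) → x , outside-S S⁻ₓ≡false undominated , S-neighbours undominated)
    ]′ (dominating⊎undominated S⁻)
    where
    open Merge pm Sᵤ S_b ub b≢ū
    not-dominating : ¬ Dominating G S⁻
    not-dominating dom⁻ = minimum-has-no-smaller minimum (dom⁻ , merged-perfect) merged-smaller

  module Trade {S m u x} (pds : IsPDSwith G S m) (Sᵤ : T (S u)) (N[u]⊆S : ∀ v → T (adj G u v) → T (S v))
               (Sₓ≡false : S x ≡ false) (xū : T (adj G x (m u))) where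

    pm : IsPerfectMatching G S m
    pm = proj₂ pds

    S⁺ : VSet n
    S⁺ = S ─ u ∪⁅ x ⁆

    x≢u : x ≢ u
    x≢u refl = subst T Sₓ≡false Sᵤ

    S─uₓ≡false : (S ─ u) x ≡ false
    S─uₓ≡false = trans (─-other {p = S} x≢u) Sₓ≡false

    S─u⊆S⁺ : ∀ v → T ((S ─ u) v) → T (S⁺ v)
    S─u⊆S⁺ v = ∪⁅⁆-⊇ {p = S ─ u}

    S⁺─x≗S─u : ∀ v → (S⁺ ─ x) v ≡ (S ─ u) v
    S⁺─x≗S─u = ∪⁅⁆-─ {p = S ─ u} S─uₓ≡false

    traded-pds : IsPDSwith G S⁺ (rematch x (m u) m)
    traded-pds = dominating-mono S─u⊆S⁺ (dominating-─ (proj₁ pds) N[u]⊆S (partner-adj pm Sᵤ)) ,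
                 rematch-perfect pm (∪⁅⁆-self {p = S ─ u} x) (S─u⊆S⁺ _ S─uᵤ̄) xū others
      where
      S─uᵤ̄ : T ((S ─ u) (m u))
      S─uᵤ̄ = ─-intro {p = S} (partner-∈ pm Sᵤ) (adj-irrefl (partner-adj pm Sᵤ) ∘ sym)
      others : ∀ v → T (S⁺ v) → v ≢ x → v ≢ m u → T (S v) × T (S⁺ (m v)) × m v ≢ x × m v ≢ m u
      others v S⁺ᵥ v≢x v≢ū with ─-elim {p = S} (subst T (∪⁅⁆-other {p = S ─ u} v≢x) S⁺ᵥ)
      ... | Sᵥ , v≢u =
        Sᵥ , S─u⊆S⁺ _ (─-intro {p = S} (partner-∈ pm Sᵥ) (v≢ū ∘ partner-flip pm Sᵥ)) ,
        (λ mv≡x → subst T Sₓ≡false (subst (T ∘ S) mv≡x (partner-∈ pm Sᵥ))) ,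
        v≢u ∘ partner-injective pm Sᵥ Sᵤ

    traded-size : count S⁺ ≡ count S
    traded-size = begin
      count S⁺               ≡⟨ count-remove S⁺ (∪⁅⁆-self {p = S ─ u} x) ⟩
      suc (count (S⁺ ─ x))   ≡⟨ cong suc (count-cong S⁺─x≗S─u) ⟩
      suc (count (S ─ u))    ≡⟨ count-remove S Sᵤ ⟨
      count S                ∎
      where open ≡-Reasoning

    traded-lam : Cubic G → dIn G S x ≤ 2 → lam G S⁺ < lam G S
    traded-lam cubic dₓ≤2 = begin-strict
      lam G S⁺
        ≡⟨ lam-─ S⁺ x (∪⁅⁆-self {p = S ─ u} x) ⟩
      lam G (S⁺ ─ x) + dIn G (S⁺ ─ x) x
        ≡⟨ cong₂ _+_ (lam-cong S⁺─x≗S─u) (count-cong λ v → cong (adj G x v ∧_) (S⁺─x≗S─u v)) ⟩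
      lam G (S ─ u) + dIn G (S ─ u) x
        ≤⟨ +-monoʳ-≤ (lam G (S ─ u)) (≤-trans (count-mono S─u⊆S) dₓ≤2) ⟩
      lam G (S ─ u) + 2
        <⟨ +-monoʳ-< (lam G (S ─ u)) (n<1+n 2) ⟩
      lam G (S ─ u) + 3
        ≡⟨ cong (lam G (S ─ u) +_) dᵤ≡3 ⟨
      lam G (S ─ u) + dIn G (S ─ u) u
        ≡⟨ lam-─ S u Sᵤ ⟨
      lam G S
        ∎
      where
      open ≤-Reasoning
      S─u⊆S : ∀ v → T (adj G x v ∧ (S ─ u) v) → T (adj G x v ∧ S v)
      S─u⊆S v t with to T-∧ t
      ... | xv , S─uᵥ = from T-∧ (xv , proj₁ (─-elim {p = S} S─uᵥ))
      N[u]⊆S─u : ∀ v → T (adj G u v) → T (adj G u v ∧ (S ─ u) v)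
      N[u]⊆S─u v uv = from T-∧ (uv , ─-intro {p = S} (N[u]⊆S v uv) (adj-irrefl uv ∘ sym))
      dᵤ≡3 : dIn G (S ─ u) u ≡ 3
      dᵤ≡3 = trans (≤-antisym (count-mono {q = adj G u} λ _ → proj₁ ∘ to T-∧) (count-mono N[u]⊆S─u))
                   (cubic u)

  no-λ-decreasing-trade : Cubic G → ∀ {S m u x} → IsChosen G S m →
    T (S u) → (∀ v → T (adj G u v) → T (S v)) → S x ≡ false → T (adj G x (m u)) → dIn G S x ≤ 2 → ⊥
  no-λ-decreasing-trade cubic (minimum@(pds , _) , λ-minimal , _) Sᵤ N[u]⊆S Sₓ≡false xū dₓ≤2 =
    <⇒≱ (traded-lam cubic dₓ≤2) (λ-minimal _ _ (minimum-of-same-size minimum traded-pds traded-size))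
    where open Trade pds Sᵤ N[u]⊆S Sₓ≡false xū

D-vertex-lacks-A-or-B-neighbour : ∀ {G : Graph n} {S m u a b} → Cubic G → IsChosen G S m → T (inD G S m u) →
  T (adj G u a ∧ inA G S m a) → T (adj G u b ∧ inB G S m b) → ⊥
D-vertex-lacks-A-or-B-neighbour {G = G} {S} {m} {u} {a} {b} cubic chosen@(minimum@((dom , pm) , _) , _) Dᵤ uA uB =
  let x , Sₓ≡false , N[x]∩S⊆ūb̄ = undominated-after-merging G minimum Sᵤ S_b ub b≢ū
  in no-λ-decreasing-trade G cubic chosen Sᵤ N[u]⊆S Sₓ≡false
       (forced-neighbour G dom Sₓ≡false N[x]∩S⊆ūb̄ (partner-∈ G pm S_b) (proj₂ (proj₂ (inB-elim G {S} {m} Bᵦ))))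
       (count≤length (m u ∷ m b ∷ []) λ y t →
          [ here , there ∘ here ]′ (N[x]∩S⊆ūb̄ y (proj₁ (to T-∧ t)) (proj₂ (to T-∧ t))))
  where
  ua : T (adj G u a)
  ua = proj₁ (to (T-∧ {adj G u a}) uA)
  ub : T (adj G u b)
  ub = proj₁ (to (T-∧ {adj G u b}) uB)
  Aₐ : T (inA G S m a)
  Aₐ = proj₂ (to (T-∧ {adj G u a}) uA)
  Bᵦ : T (inB G S m b)
  Bᵦ = proj₂ (to (T-∧ {adj G u b}) uB)
  Sᵤ : T (S u)
  Sᵤ = proj₁ (inD-elim G {S} {m} Dᵤ)
  S_b : T (S b)
  S_b = proj₁ (inB-elim G {S} {m} Bᵦ)

  b≢ū : b ≢ m u
  b≢ū refl = <⇒≱ (proj₁ (proj₂ (inB-elim G {S} {m} Bᵦ)))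
                  (≤-reflexive (proj₂ (proj₂ (inD-elim G {S} {m} Dᵤ))))
  a≢ū : a ≢ m u
  a≢ū refl = inD⇒partner-¬inA G pm Dᵤ Aₐ
  a≢b : a ≢ b
  a≢b refl = inB⇒¬inA G cubic pm Bᵦ Sᵤ (adjacent-sym G ub) (b≢ū ∘ partner-flip G pm S_b ∘ sym) Aₐ

  N[u]⊆S : ∀ v → T (adj G u v) → T (S v)
  N[u]⊆S v uv = All.lookup (partner-∈ G pm Sᵤ ∷ proj₁ (inA-elim G {S} {m} Aₐ) ∷ S_b ∷ [])
    (count≡length⇒∈ {p = adj G u} ((a≢ū ∘ sym ∷ b≢ū ∘ sym ∷ []) ∷ (a≢b ∷ []) ∷ [] ∷ [])
                     (partner-adj G pm Sᵤ ∷ ua ∷ ub ∷ []) (cubic u) uv)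

lemma6 : ∀ {n : ℕ} (G : Graph n) → Cubic G → Connected G →
    (S : VSet n) (m : Fin n → Fin n) → IsChosen G S m →
    (r : Fin n) → T (S r) → NoLinkedDPairs G S m r →
    (u : Fin n) → InComp G S r u → T (inD G S m u) →
    ¬ ((dIn G (inA G S m) u ≡ 1) × (dIn G (inB G S m) u ≡ 1) × (dIn G (inD G S m) u ≡ 1))
lemma6 G cubic _ S m chosen _ _ _ u _ Dᵤ (dA≡1 , dB≡1 , _) =
  D-vertex-lacks-A-or-B-neighbour {G = G} cubic chosen Dᵤ
    (proj₂ (count-witness {p = λ w → adj G u w ∧ inA G S m w} (≤-reflexive (sym dA≡1))))
    (proj₂ (count-witness {p = λ w → adj G u w ∧ inB G S m w} (≤-reflexive (sym dB≡1))))
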